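{- Let $G=\sum_{i=1}^h C_{2m_i}+\sum_{j=1}^k C_{2n_j+1}$ (disjoint union of $h$ even cycles and $k$ odd cycles), where $m_i\ge2$, $n_j\ge1$, $h,k\ge 0$ and $h+k\ge1$, and let $p=|V(G)|$. Then $str(G)=\max\{p+2,\ p+1+k\}$.
   Context: $C_n$ is the cycle on $n$ vertices; $+$ denotes disjoint union (an empty sum is omitted). For a graph $G$ of order $p$, a numbering is a bijection $f:V(G)\to\{1,\dots,p\}$; $str_f(G)=\max\{f(u)+f(v): uv\in E(G)\}$ and $str(G)=\min\{str_f(G): f \text{ a numbering of } G\}$. -}

module Defs where

open import Data.Nat using (ℕ; zero; suc; _+_; _*_; _⊔_; _≤_)
open import Data.Nat.DivMod using (_mod_)
open import Data.Fin using (Fin; toℕ)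
open import Data.List using (List; length; lookup; map; concatMap; foldr; _++_; allFin)
open import Data.Nat.ListAction using (sum)
open import Data.Product using (Σ; _×_; _,_; proj₁; proj₂)
open import Function.Bundles using (_⤖_; Bijection)
open import Relation.Binary.PropositionalEquality using (_≡_)

-- A disjoint union of cycles is given by the list L of cycle lengths.
-- Vertices: pairs (i , a) with i the index of the cycle and a a position in it.
Vertex : List ℕ → Set
Vertex L = Σ (Fin (length L)) (λ i → Fin (lookup L i))

next : ∀ {n} → Fin n → Fin n
next {suc m} a = suc (toℕ a) mod (suc m)

cycleEdges : (L : List ℕ) → (i : Fin (length L)) → List (Vertex L × Vertex L)
cycleEdges L i = map (λ a → ((i , a) , (i , next a))) (allFin (lookup L i))

edges : (L : List ℕ) → List (Vertex L × Vertex L)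
edges L = concatMap (cycleEdges L) (allFin (length L))

order : List ℕ → ℕ
order L = sum L

-- a numbering: bijection V(G) → {1,…,p}, encoded as V(G) ⤖ Fin p
-- (vertex v gets the number toℕ (f v) + 1)
Numbering : List ℕ → Set
Numbering L = Vertex L ⤖ Fin (order L)

label : ∀ {L} → Numbering L → Vertex L → ℕ
label f v = suc (toℕ (Bijection.to f v))

strF : (L : List ℕ) → Numbering L → ℕ
strF L f = foldr (λ e acc → (label {L} f (proj₁ e) + label {L} f (proj₂ e)) ⊔ acc) 0 (edges L)

IsStrength : List ℕ → ℕ → Set
IsStrength L s = Σ (Numbering L) (λ f → strF L f ≡ s) × ((f : Numbering L) → s ≤ strF L f)

cycleList : List ℕ → List ℕ → List ℕ
cycleList ms ns = map (λ m → 2 * m) ms ++ map (λ n → 2 * n + 1) ns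

module Submission where

-- The vertex numbered p has two distinct neighbours, and at most one of them is numbered 1,
-- so str(G) ≥ p + 2. If a numbering has strength s ≤ 2q + 2, the vertices numbered above q
-- are pairwise non-adjacent; an independent set of C_c has at most ⌊c/2⌋ vertices, so
-- p − q ≤ Σ ⌊c/2⌋, i.e. q ≥ E := Σ ⌈c/2⌉, and s ≥ 2E + 1 = p + k + 1.
-- Conversely, number the even positions of all cycles by 1, 2, …, E and the odd positions
-- by p, p − 1, …, cycle by cycle and even cycles first. An edge inside a cycle then has
-- label sum at most p + 2 plus the number of odd cycles numbered earlier, and the closing
-- edge of an odd cycle joins two small labels with sum at most 2E − 1.

open import Defs
open import Data.Nat using (ℕ; zero; suc; pred; z<s; >-nonZero; _+_; _*_; _∸_; _⊔_; _≤_; _<_; z≤n; s≤s; s≤s⁻¹; ⌊_/2⌋; ⌈_/2⌉; parity; _<?_; _≤?_)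
open import Data.Nat.Properties
open import Data.Nat.DivMod using (_%_; m<n⇒m%n≡m; n%n≡0)
open import Data.Nat.ListAction using (sum)
open import Data.Nat.Tactic.RingSolver using (solve-∀)
open import Data.Parity.Base using (0ℙ; 1ℙ; _⁻¹)
open import Data.Parity.Properties using (p≢p⁻¹; suc-homo-⁻¹)
open import Data.Fin as Fin using (Fin; toℕ; fromℕ; fromℕ<; punchOut)
open import Data.Fin.Properties using (toℕ-injective; toℕ-fromℕ<; toℕ<n; toℕ-fromℕ; toℕ-inject₁; punchOut-injective; any?; injective⇒≤)
open import Data.List using (List; []; _∷_; length; lookup; map; foldr; allFin)
open import Data.List.Membership.Propositional using (_∈_)
open import Data.List.Membership.Propositional.Properties using (∈-map⁺; ∈-map⁻; ∈-concat⁺′; ∈-concat⁻′; ∈-allFin; ∈-lookup)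
open import Data.List.Properties using (length-++; length-map)
open import Data.List.Relation.Unary.Any using (here; there)
open import Data.List.Relation.Unary.All as All using (All)
open import Data.List.Relation.Unary.All.Properties using (++⁺; map⁺)
open import Data.Product using (Σ; ∃; _×_; _,_; proj₁; proj₂; map₂)
open import Data.Sum using (_⊎_; inj₁; inj₂)
open import Data.Empty using (⊥)
open import Relation.Nullary using (Dec; yes; no; contradiction)
open import Relation.Unary using (Decidable)
open import Relation.Binary.Definitions using (tri<; tri≈; tri>)
open import Relation.Binary.PropositionalEquality
open import Algebra.Properties.CommutativeSemigroup +-commutativeSemigroup using (interchange; x∙yz≈y∙xz; xy∙z≈y∙xz)
open import Function.Definitions using (Injective; Surjective)
open import Function.Base using (id)
open import Function.Bundles using (mk⤖; Bijection; module Surjection)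

toℕ-next-< : ∀ {n} (a : Fin n) → suc (toℕ a) < n → toℕ (next a) ≡ suc (toℕ a)
toℕ-next-< {suc m} a h = trans (toℕ-fromℕ< _) (m<n⇒m%n≡m h)

toℕ-next-last : ∀ {n} (a : Fin n) → suc (toℕ a) ≡ n → toℕ (next a) ≡ 0
toℕ-next-last {suc m} a h = trans (toℕ-fromℕ< _) (trans (cong (_% suc m) h) (n%n≡0 (suc m)))

toℕ-next : ∀ {n} (a : Fin n) →
  (suc (toℕ a) < n × toℕ (next a) ≡ suc (toℕ a)) ⊎ (suc (toℕ a) ≡ n × toℕ (next a) ≡ 0)
toℕ-next a with m≤n⇒m<n∨m≡n (toℕ<n a)
... | inj₁ h = inj₁ (h , toℕ-next-< a h)
... | inj₂ h = inj₂ (h , toℕ-next-last a h)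

next-suc : ∀ {n} {a b : Fin n} → toℕ b ≡ suc (toℕ a) → next a ≡ b
next-suc {b = b} e = toℕ-injective (trans (toℕ-next-< _ (subst (_< _) e (toℕ<n b))) (sym e))

next-fromℕ : ∀ n → next (fromℕ n) ≡ Fin.zero
next-fromℕ n = toℕ-injective (toℕ-next-last (fromℕ n) (cong suc (toℕ-fromℕ n)))

next-surjective : ∀ {n} (a : Fin n) → ∃ λ b → next b ≡ a
next-surjective {suc m} Fin.zero = fromℕ m , next-fromℕ m
next-surjective {suc m} (Fin.suc a) = Fin.inject₁ a , next-suc (cong suc (sym (toℕ-inject₁ a)))

next≢id : ∀ {n} → 2 ≤ n → (a : Fin n) → next a ≢ a
next≢id 2≤n a eq with toℕ-next a
... | inj₁ (_ , e) = 1+n≢n (trans (sym e) (cong toℕ eq))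
... | inj₂ (last , e) = <⇒≱ 2≤n (≤-reflexive (trans (sym last) (cong suc (trans (sym (cong toℕ eq)) e))))

next∘next≢id : ∀ {n} → 3 ≤ n → (a : Fin n) → next (next a) ≢ a
next∘next≢id {n} 3≤n a eq with toℕ-next a | toℕ-next (next a)
... | inj₁ (_ , e₁) | inj₁ (_ , e₂) =
  <⇒≢ (m<n⇒m<1+n (n<1+n _)) (trans (sym (cong toℕ eq)) (trans e₂ (cong suc e₁)))
... | inj₁ (_ , e₁) | inj₂ (last , e₂) =
  <⇒≱ 3≤n (≤-reflexive (trans (sym last) (cong suc (trans e₁ (cong suc (trans (sym (cong toℕ eq)) e₂))))))
... | inj₂ (last , e₁) | inj₁ (_ , e₂) =
  <⇒≱ 3≤n (≤-reflexive (trans (sym last) (cong suc (trans (sym (cong toℕ eq)) (trans e₂ (cong suc e₁))))))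
... | inj₂ (_ , e₁) | inj₂ (last , _) =
  <⇒≱ 3≤n (≤-trans (≤-reflexive (trans (sym last) (cong suc e₁))) (n≤1+n 1))

injective⇒surjective : ∀ {n} (f : Fin n → Fin n) → Injective _≡_ _≡_ f → ∀ t → ∃ λ x → f x ≡ t
injective⇒surjective {zero} f inj ()
injective⇒surjective {suc n} f inj t with any? (λ x → f x Data.Fin.Properties.≟ t)
... | yes hit = hit
... | no miss = contradiction (injective⇒≤ squeeze-injective) (<-irrefl refl)
  where
  avoids : ∀ x → t ≢ f x
  avoids x eq = miss (x , sym eq)
  squeeze : Fin (suc n) → Fin n
  squeeze x = punchOut (avoids x)
  squeeze-injective : Injective _≡_ _≡_ squeeze
  squeeze-injective {x} {y} eq = inj (punchOut-injective (avoids x) (avoids y) eq)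

sumBefore : (ℕ → ℕ) → (L : List ℕ) → Fin (length L) → ℕ
sumBefore g (c ∷ L) Fin.zero = 0
sumBefore g (c ∷ L) (Fin.suc i) = g c + sumBefore g L i

sumBefore+≤sum : ∀ g L i → sumBefore g L i + g (lookup L i) ≤ sum (map g L)
sumBefore+≤sum g (c ∷ L) Fin.zero = m≤m+n (g c) _
sumBefore+≤sum g (c ∷ L) (Fin.suc i) =
  subst (_≤ g c + sum (map g L)) (sym (+-assoc (g c) _ _)) (+-monoʳ-≤ (g c) (sumBefore+≤sum g L i))

sumBefore-< : ∀ g L i {x} → x < g (lookup L i) → sumBefore g L i + x < sum (map g L)
sumBefore-< g L i x< = <-≤-trans (+-monoʳ-< (sumBefore g L i) x<) (sumBefore+≤sum g L i)

sumBefore-injective : ∀ g L i j {x y} → x < g (lookup L i) → y < g (lookup L j) →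
  sumBefore g L i + x ≡ sumBefore g L j + y → i ≡ j × x ≡ y
sumBefore-injective g (c ∷ L) Fin.zero Fin.zero x< y< eq = refl , eq
sumBefore-injective g (c ∷ L) Fin.zero (Fin.suc j) x< y< eq =
  contradiction (subst (g c ≤_) (sym eq) (≤-trans (m≤m+n (g c) _) (m≤m+n _ _))) (<⇒≱ x<)
sumBefore-injective g (c ∷ L) (Fin.suc i) Fin.zero x< y< eq =
  contradiction (subst (g c ≤_) eq (≤-trans (m≤m+n (g c) _) (m≤m+n _ _))) (<⇒≱ y<)
sumBefore-injective g (c ∷ L) (Fin.suc i) (Fin.suc j) x< y< eq
  with sumBefore-injective g L i j x< y<
         (+-cancelˡ-≡ (g c) _ _ (trans (sym (+-assoc (g c) _ _)) (trans eq (+-assoc (g c) _ _))))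
... | refl , x≡y = refl , x≡y

flatten : ∀ L → Vertex L → ℕ
flatten L (i , a) = sumBefore id L i + toℕ a

unflatten : ∀ L n → n < sum L → Σ (Vertex L) λ v → flatten L v ≡ n
unflatten (c ∷ L) n n< with n <? c
... | yes n<c = (Fin.zero , fromℕ< n<c) , toℕ-fromℕ< n<c
... | no n≮c with unflatten L (n ∸ c) (+-cancelˡ-< c _ _ (subst (_< c + sum L) (sym (m+[n∸m]≡n (≮⇒≥ n≮c))) n<))
...   | (i , a) , e = (Fin.suc i , a) , (begin
  (c + sumBefore id L i) + toℕ a ≡⟨ +-assoc c _ _ ⟩
  c + (sumBefore id L i + toℕ a) ≡⟨ cong (c +_) e ⟩
  c + (n ∸ c)                           ≡⟨ m+[n∸m]≡n (≮⇒≥ n≮c) ⟩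
  n                                     ∎)
  where open ≡-Reasoning

vertexAt : ∀ L → Fin (order L) → Vertex L
vertexAt L t = proj₁ (unflatten L (toℕ t) (toℕ<n t))

vertexAt-injective : ∀ L → Injective _≡_ _≡_ (vertexAt L)
vertexAt-injective L {t} {u} eq = toℕ-injective (begin
  toℕ t                  ≡⟨ sym (proj₂ (unflatten L (toℕ t) (toℕ<n t))) ⟩
  flatten L (vertexAt L t) ≡⟨ cong (flatten L) eq ⟩
  flatten L (vertexAt L u) ≡⟨ proj₂ (unflatten L (toℕ u) (toℕ<n u)) ⟩
  toℕ u                  ∎)
  where open ≡-Reasoning

injective⇒numbering : ∀ L (h : Vertex L → Fin (order L)) → Injective _≡_ _≡_ h → Numbering L
injective⇒numbering L h h-injective = mk⤖ (h-injective , h-surjective)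
  where
  h-surjective : Surjective _≡_ _≡_ h
  h-surjective t
    with injective⇒surjective (λ x → h (vertexAt L x)) (λ eq → vertexAt-injective L (h-injective eq)) t
  ... | x , hx≡t = vertexAt L x , λ { refl → hx≡t }

foldr-⊔-≤ : ∀ {A : Set} (w : A → ℕ) es {s} → (∀ {e} → e ∈ es → w e ≤ s) → foldr (λ e acc → w e ⊔ acc) 0 es ≤ s
foldr-⊔-≤ w [] bound = z≤n
foldr-⊔-≤ w (e ∷ es) bound = ⊔-lub (bound (here refl)) (foldr-⊔-≤ w es (λ e∈ → bound (there e∈)))

≤-foldr-⊔ : ∀ {A : Set} (w : A → ℕ) es {e} → e ∈ es → w e ≤ foldr (λ e acc → w e ⊔ acc) 0 es
≤-foldr-⊔ w (e ∷ es) (here refl) = m≤m⊔n _ _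
≤-foldr-⊔ w (x ∷ es) (there e∈) = ≤-trans (≤-foldr-⊔ w es e∈) (m≤n⊔m _ _)

module _ (L : List ℕ) (f : Numbering L) where

  private
    edgeSum : Vertex L × Vertex L → ℕ
    edgeSum (u , w) = label {L} f u + label {L} f w

  edge≤strF : ∀ i a → label {L} f (i , a) + label {L} f (i , next a) ≤ strF L f
  edge≤strF i a = ≤-foldr-⊔ edgeSum (edges L)
    (∈-concat⁺′ (∈-map⁺ _ (∈-allFin a)) (∈-map⁺ (cycleEdges L) (∈-allFin i)))

  strF≤ : ∀ {s} → (∀ i a → label {L} f (i , a) + label {L} f (i , next a) ≤ s) → strF L f ≤ s
  strF≤ bound = foldr-⊔-≤ edgeSum (edges L) edge-bound
    where
    edge-bound : ∀ {e} → e ∈ edges L → edgeSum e ≤ _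
    edge-bound e∈ with ∈-concat⁻′ (map (cycleEdges L) (allFin (length L))) e∈
    ... | es , e∈es , es∈ with ∈-map⁻ (cycleEdges L) es∈
    ... | i , _ , refl with ∈-map⁻ _ e∈es
    ... | a , _ , refl = bound i a

-- Independent sets of a union of cycles

⌊m/2⌋≡⌊n/2⌋⇒m≡n∨adjacent : ∀ m n → ⌊ m /2⌋ ≡ ⌊ n /2⌋ → m ≡ n ⊎ (n ≡ suc m ⊎ m ≡ suc n)
⌊m/2⌋≡⌊n/2⌋⇒m≡n∨adjacent 0 0 _ = inj₁ refl
⌊m/2⌋≡⌊n/2⌋⇒m≡n∨adjacent 0 1 _ = inj₂ (inj₁ refl)
⌊m/2⌋≡⌊n/2⌋⇒m≡n∨adjacent 1 0 _ = inj₂ (inj₂ refl)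
⌊m/2⌋≡⌊n/2⌋⇒m≡n∨adjacent 1 1 _ = inj₁ refl
⌊m/2⌋≡⌊n/2⌋⇒m≡n∨adjacent 0 (suc (suc n)) ()
⌊m/2⌋≡⌊n/2⌋⇒m≡n∨adjacent 1 (suc (suc n)) ()
⌊m/2⌋≡⌊n/2⌋⇒m≡n∨adjacent (suc (suc m)) 0 ()
⌊m/2⌋≡⌊n/2⌋⇒m≡n∨adjacent (suc (suc m)) 1 ()
⌊m/2⌋≡⌊n/2⌋⇒m≡n∨adjacent (suc (suc m)) (suc (suc n)) eq
  with ⌊m/2⌋≡⌊n/2⌋⇒m≡n∨adjacent m n (suc-injective eq)
... | inj₁ m≡n = inj₁ (cong (2 +_) m≡n)
... | inj₂ (inj₁ n≡1+m) = inj₂ (inj₁ (cong (2 +_) n≡1+m))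
... | inj₂ (inj₂ m≡1+n) = inj₂ (inj₂ (cong (2 +_) m≡1+n))

∸-suc-cancel : ∀ {δ x y} → δ ≤ x → δ ≤ y → y ∸ δ ≡ suc (x ∸ δ) → y ≡ suc x
∸-suc-cancel {δ} {x} {y} δ≤x δ≤y eq = begin
  y               ≡⟨ sym (m∸n+n≡m δ≤y) ⟩
  y ∸ δ + δ       ≡⟨ cong (_+ δ) eq ⟩
  suc (x ∸ δ + δ) ≡⟨ cong suc (m∸n+n≡m δ≤x) ⟩
  suc x           ∎
  where open ≡-Reasoning

record Slotting {c : ℕ} (I : Fin c → Set) : Set where
  field
    slot           : Fin c → ℕ
    slot-<         : ∀ a → I a → slot a < ⌊ c /2⌋
    slot-injective : ∀ a b → I a → I b → slot a ≡ slot b → a ≡ b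

-- a ↦ ⌊a/2⌋ pairs up consecutive positions, so it is injective on an independent set; it can
-- leave the range ⌊c/2⌋ only at the last position, and if that one lies in I then position 0
-- does not, so shifting every position down by one repairs it.
module CycleSlots {d : ℕ} (I : Fin (suc (suc d)) → Set) (independent : ∀ a → I a → I (next a) → ⊥) where

  Admissible : ℕ → Set
  Admissible δ = ∀ a → I a → δ ≤ toℕ a × toℕ a ∸ δ ≤ d

  admissible : Dec (I (fromℕ (suc d))) → ∃ Admissible
  admissible (yes last∈I) = 1 , shifted
    where
    shifted : Admissible 1
    shifted Fin.zero 0∈I = contradiction (subst I (sym (next-fromℕ (suc d))) 0∈I) (independent _ last∈I)
    shifted (Fin.suc a) _ = s≤s z≤n , s≤s⁻¹ (toℕ<n a)
  admissible (no last∉I) = 0 , unshifted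
    where
    unshifted : Admissible 0
    unshifted a a∈I = z≤n , s≤s⁻¹ (≤∧≢⇒< (s≤s⁻¹ (toℕ<n a)) a≢last)
      where
      a≢last : toℕ a ≢ suc d
      a≢last eq = last∉I (subst I (toℕ-injective (trans eq (sym (toℕ-fromℕ (suc d))))) a∈I)

  slotting : ∀ {δ} → Admissible δ → Slotting I
  slotting {δ} adm = record { slot = slot ; slot-< = slot-< ; slot-injective = slot-injective }
    where
    slot : Fin (suc (suc d)) → ℕ
    slot a = ⌊ toℕ a ∸ δ /2⌋

    slot-< : ∀ a → I a → slot a < ⌊ suc (suc d) /2⌋
    slot-< a a∈I = s≤s (⌊n/2⌋-mono (proj₂ (adm a a∈I)))

    adjacent : ∀ {a b} → I a → I b → toℕ b ∸ δ ≡ suc (toℕ a ∸ δ) → ⊥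
    adjacent {a} {b} a∈I b∈I eq = independent a a∈I (subst I (sym (next-suc b≡a+1)) b∈I)
      where
      b≡a+1 : toℕ b ≡ suc (toℕ a)
      b≡a+1 = ∸-suc-cancel (proj₁ (adm a a∈I)) (proj₁ (adm b b∈I)) eq

    slot-injective : ∀ a b → I a → I b → slot a ≡ slot b → a ≡ b
    slot-injective a b a∈I b∈I eq with ⌊m/2⌋≡⌊n/2⌋⇒m≡n∨adjacent (toℕ a ∸ δ) (toℕ b ∸ δ) eq
    ... | inj₁ same = toℕ-injective (∸-cancelʳ-≡ (proj₁ (adm a a∈I)) (proj₁ (adm b b∈I)) same)
    ... | inj₂ (inj₁ b-after-a) = contradiction b-after-a (adjacent a∈I b∈I)
    ... | inj₂ (inj₂ a-after-b) = contradiction a-after-b (adjacent b∈I a∈I)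

independent-slotting : ∀ {c} → 2 ≤ c → (I : Fin c → Set) → Decidable I →
  (∀ a → I a → I (next a) → ⊥) → Slotting I
independent-slotting {suc zero} (s≤s ())
independent-slotting {suc (suc d)} _ I I? independent = slotting (proj₂ (admissible (I? (fromℕ (suc d)))))
  where open CycleSlots I independent

oddPositions evenPositions : List ℕ → ℕ
oddPositions L = sum (map ⌊_/2⌋ L)
evenPositions L = sum (map ⌈_/2⌉ L)

order≡evenPositions+oddPositions : ∀ L → order L ≡ evenPositions L + oddPositions L
order≡evenPositions+oddPositions [] = refl
order≡evenPositions+oddPositions (c ∷ L) = begin
  c + order L                           ≡⟨ cong₂ _+_ c≡⌈c/2⌉+⌊c/2⌋ (order≡evenPositions+oddPositions L) ⟩
  (⌈ c /2⌉ + ⌊ c /2⌋) + (E + O)         ≡⟨ interchange ⌈ c /2⌉ ⌊ c /2⌋ E O ⟩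
  (⌈ c /2⌉ + E) + (⌊ c /2⌋ + O)         ∎
  where
  open ≡-Reasoning
  E = evenPositions L
  O = oddPositions L
  c≡⌈c/2⌉+⌊c/2⌋ : c ≡ ⌈ c /2⌉ + ⌊ c /2⌋
  c≡⌈c/2⌉+⌊c/2⌋ = trans (sym (⌊n/2⌋+⌈n/2⌉≡n c)) (+-comm ⌊ c /2⌋ ⌈ c /2⌉)

Independent : ∀ L → (Vertex L → Set) → Set
Independent L I = ∀ i a → I (i , a) → I (i , next a) → ⊥

independent≤oddPositions : ∀ L → (∀ i → 2 ≤ lookup L i) → {I : Vertex L → Set} → Decidable I →
  Independent L I → ∀ {m} (e : Fin m → Vertex L) → Injective _≡_ _≡_ e → (∀ t → I (e t)) →
  m ≤ oddPositions L
independent≤oddPositions L long {I} I? independent {m} e e-injective e∈I = injective⇒≤ code-injective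
  where
  slotting : ∀ i → Slotting (λ a → I (i , a))
  slotting i = independent-slotting (long i) _ (λ a → I? (i , a)) (independent i)

  open Slotting

  globalSlot : Vertex L → ℕ
  globalSlot (i , a) = sumBefore ⌊_/2⌋ L i + slot (slotting i) a

  globalSlot-< : ∀ v → I v → globalSlot v < oddPositions L
  globalSlot-< (i , a) a∈I = sumBefore-< ⌊_/2⌋ L i (slot-< (slotting i) a a∈I)

  globalSlot-injective : ∀ v w → I v → I w → globalSlot v ≡ globalSlot w → v ≡ w
  globalSlot-injective (i , a) (j , b) a∈I b∈I eq
    with sumBefore-injective ⌊_/2⌋ L i j (slot-< (slotting i) a a∈I) (slot-< (slotting j) b b∈I) eq
  ... | refl , same-slot = cong (i ,_) (slot-injective (slotting i) a b a∈I b∈I same-slot)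

  code : Fin m → Fin (oddPositions L)
  code t = fromℕ< (globalSlot-< (e t) (e∈I t))

  code-injective : Injective _≡_ _≡_ code
  code-injective eq = e-injective (globalSlot-injective _ _ (e∈I _) (e∈I _)
    (trans (sym (toℕ-fromℕ< _)) (trans (cong toℕ eq) (toℕ-fromℕ< _))))

-- Lower bounds

m<o∸n⇒n+m<o : ∀ {m n o} → m < o ∸ n → n + m < o
m<o∸n⇒n+m<o {m} {n} {o} m<o∸n = subst (n + m <_) (m+[n∸m]≡n n≤o) (+-monoʳ-< n m<o∸n)
  where
  n≤o : n ≤ o
  n≤o = <⇒≤ (m∸n≢0⇒n<m λ o∸n≡0 → <⇒≱ m<o∸n (subst (_≤ m) (sym o∸n≡0) z≤n))

⌊n/2⌋+⌊n/2⌋≤n : ∀ n → ⌊ n /2⌋ + ⌊ n /2⌋ ≤ n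
⌊n/2⌋+⌊n/2⌋≤n 0 = z≤n
⌊n/2⌋+⌊n/2⌋≤n 1 = z≤n
⌊n/2⌋+⌊n/2⌋≤n (suc (suc n)) = s≤s (subst (_≤ suc n) (sym (+-suc ⌊ n /2⌋ ⌊ n /2⌋)) (s≤s (⌊n/2⌋+⌊n/2⌋≤n n)))

n≤1+⌊n/2⌋+⌊n/2⌋ : ∀ n → n ≤ suc (⌊ n /2⌋ + ⌊ n /2⌋)
n≤1+⌊n/2⌋+⌊n/2⌋ 0 = z≤n
n≤1+⌊n/2⌋+⌊n/2⌋ 1 = s≤s z≤n
n≤1+⌊n/2⌋+⌊n/2⌋ (suc (suc n)) = s≤s (s≤s (subst (n ≤_) (sym (+-suc ⌊ n /2⌋ ⌊ n /2⌋)) (n≤1+⌊n/2⌋+⌊n/2⌋ n)))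

ordered-above : ∀ {q x y} → q ≤ x → x < y → suc (suc (suc (q + q))) ≤ suc x + suc y
ordered-above {q} q≤x x<y = ≤-trans (≤-reflexive (3+2q q)) (+-mono-≤ (s≤s q≤x) (s≤s (≤-trans (s≤s q≤x) x<y)))
  where
  3+2q : ∀ q → suc (suc (suc (q + q))) ≡ suc q + suc (suc q)
  3+2q = solve-∀

distinct-above : ∀ {q x y} → q ≤ x → q ≤ y → x ≢ y → suc (suc (suc (q + q))) ≤ suc x + suc y
distinct-above {q} {x} {y} q≤x q≤y x≢y with <-cmp x y
... | tri< x<y _ _ = ordered-above q≤x x<y
... | tri≈ _ x≡y _ = contradiction x≡y x≢y
... | tri> _ _ y<x = subst (suc (suc (suc (q + q))) ≤_) (+-comm (suc y) (suc x)) (ordered-above q≤y y<x)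

module _ (L : List ℕ) (f : Numbering L) where
  open Bijection f using (injective) renaming (to to φ)
  open Surjection (Bijection.surjection f) using (to⁻; to∘to⁻)

  private
    position-injective : ∀ {i} {a b : Fin (lookup L i)} → φ (i , a) ≡ φ (i , b) → a ≡ b
    position-injective eq = toℕ-injective (cong (λ v → toℕ (proj₂ v)) (injective eq))

  order+2≤strF : (∀ i → 3 ≤ lookup L i) → 1 ≤ order L → order L + 2 ≤ strF L f
  order+2≤strF long 1≤p with order L + 2 ≤? strF L f
  ... | yes p+2≤s = p+2≤s
  ... | no p+2≰s = contradiction (trans (cong next b-after-top) top-between) (next∘next≢id (long i) b)
    where
    p = order L
    ℓ = label {L} f
    s≤p+1 : strF L f ≤ p + 1
    s≤p+1 = s≤s⁻¹ (subst (strF L f <_) (+-suc p 1) (≰⇒> p+2≰s))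
    numbered-1 : ∀ {u} → p + ℓ u ≤ strF L f → toℕ (φ u) ≡ 0
    numbered-1 bound = n≤0⇒n≡0 (s≤s⁻¹ (+-cancelˡ-≤ p _ 1 (≤-trans bound s≤p+1)))
    p≡1+pred-p : suc (pred p) ≡ p
    p≡1+pred-p = suc-pred p {{>-nonZero 1≤p}}
    top : Vertex L
    top = to⁻ (fromℕ< (≤-reflexive p≡1+pred-p))
    label-top : ℓ top ≡ p
    label-top = trans (cong (λ t → suc (toℕ t)) (to∘to⁻ _)) (trans (cong suc (toℕ-fromℕ< _)) p≡1+pred-p)
    i = proj₁ top
    a = proj₂ top
    b = proj₁ (next-surjective a)
    b-after-top : next b ≡ a
    b-after-top = proj₂ (next-surjective a)
    open ≤-Reasoning
    next-top-numbered-1 : toℕ (φ (i , next a)) ≡ 0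
    next-top-numbered-1 = numbered-1 (begin
      p + ℓ (i , next a)     ≡⟨ cong (_+ ℓ (i , next a)) label-top ⟨
      ℓ top + ℓ (i , next a) ≤⟨ edge≤strF L f i a ⟩
      strF L f               ∎)
    b-numbered-1 : toℕ (φ (i , b)) ≡ 0
    b-numbered-1 = numbered-1 (begin
      p + ℓ (i , b)             ≡⟨ cong (_+ ℓ (i , b)) label-top ⟨
      ℓ top + ℓ (i , b)         ≡⟨ +-comm (ℓ top) _ ⟩
      ℓ (i , b) + ℓ (i , a)     ≡⟨ cong (λ x → ℓ (i , b) + ℓ (i , x)) b-after-top ⟨
      ℓ (i , b) + ℓ (i , next b) ≤⟨ edge≤strF L f i b ⟩
      strF L f                  ∎)
    top-between : next a ≡ b
    top-between = position-injective (toℕ-injective (trans next-top-numbered-1 (sym b-numbered-1)))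

  Above : ℕ → Vertex L → Set
  Above q v = q ≤ toℕ (φ v)

  above-independent : (∀ i → 2 ≤ lookup L i) → ∀ q → strF L f ≤ suc (suc (q + q)) → Independent L (Above q)
  above-independent long q s≤2q+2 i a a-above next-above =
    <-irrefl refl (≤-trans (distinct-above a-above next-above distinct) (≤-trans (edge≤strF L f i a) s≤2q+2))
    where
    distinct : toℕ (φ (i , a)) ≢ toℕ (φ (i , next a))
    distinct eq = next≢id (long i) a (sym (position-injective (toℕ-injective eq)))

  order∸≤oddPositions : (∀ i → 2 ≤ lookup L i) → ∀ q → Independent L (Above q) →
    order L ∸ q ≤ oddPositions L
  order∸≤oddPositions long q independent =
    independent≤oddPositions L long (λ v → q ≤? toℕ (φ v)) independent above above-injective above-Above
    where
    above : Fin (order L ∸ q) → Vertex L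
    above t = to⁻ (fromℕ< (m<o∸n⇒n+m<o (toℕ<n t)))
    φ-above : ∀ t → toℕ (φ (above t)) ≡ q + toℕ t
    φ-above t = trans (cong toℕ (to∘to⁻ _)) (toℕ-fromℕ< _)
    above-injective : Injective _≡_ _≡_ above
    above-injective {t} {u} eq = toℕ-injective (+-cancelˡ-≡ q _ _
      (trans (sym (φ-above t)) (trans (cong (λ v → toℕ (φ v)) eq) (φ-above u))))
    above-Above : ∀ t → Above q (above t)
    above-Above t = subst (q ≤_) (sym (φ-above t)) (m≤m+n q _)

  2*evenPositions<strF : (∀ i → 2 ≤ lookup L i) → 1 ≤ strF L f →
    suc (evenPositions L + evenPositions L) ≤ strF L f
  2*evenPositions<strF long 1≤s = begin
    suc (E + E)        ≤⟨ s≤s (+-mono-≤ E≤q E≤q) ⟩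
    suc (q + q)        ≤⟨ s≤s (⌊n/2⌋+⌊n/2⌋≤n (pred s)) ⟩
    suc (pred s)       ≡⟨ s≡1+pred-s ⟩
    s                  ∎
    where
    open ≤-Reasoning
    s = strF L f
    E = evenPositions L
    O = oddPositions L
    q = ⌊ pred s /2⌋
    s≡1+pred-s : suc (pred s) ≡ s
    s≡1+pred-s = suc-pred s {{>-nonZero 1≤s}}
    s≤2q+2 : s ≤ suc (suc (q + q))
    s≤2q+2 = subst (_≤ suc (suc (q + q))) s≡1+pred-s (s≤s (n≤1+⌊n/2⌋+⌊n/2⌋ (pred s)))
    E≤q : E ≤ q
    E≤q = +-cancelʳ-≤ O E q (begin
      E + O             ≡⟨ order≡evenPositions+oddPositions L ⟨
      order L           ≤⟨ m≤n+m∸n (order L) q ⟩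
      q + (order L ∸ q) ≤⟨ +-monoʳ-≤ q (order∸≤oddPositions long q (above-independent long q s≤2q+2)) ⟩
      q + O             ∎)

-- The extremal numbering

parity-suc≢ : ∀ n → parity (suc n) ≢ parity n
parity-suc≢ n eq = p≢p⁻¹ (parity n) (trans (sym (suc-homo-⁻¹ n)) (cong _⁻¹ eq))

parity-⌊/2⌋-injective : ∀ m n → parity m ≡ parity n → ⌊ m /2⌋ ≡ ⌊ n /2⌋ → m ≡ n
parity-⌊/2⌋-injective m n same-parity eq with ⌊m/2⌋≡⌊n/2⌋⇒m≡n∨adjacent m n eq
... | inj₁ m≡n = m≡n
... | inj₂ (inj₁ refl) = contradiction (sym same-parity) (parity-suc≢ m)
... | inj₂ (inj₂ refl) = contradiction same-parity (parity-suc≢ n)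

⌊1+n/2⌋-even : ∀ n → parity n ≡ 0ℙ → parity (suc n) ≡ 1ℙ × ⌊ suc n /2⌋ ≡ ⌊ n /2⌋
⌊1+n/2⌋-even 0 _ = refl , refl
⌊1+n/2⌋-even (suc (suc n)) even = map₂ (cong suc) (⌊1+n/2⌋-even n even)

⌊1+n/2⌋-odd : ∀ n → parity n ≡ 1ℙ → parity (suc n) ≡ 0ℙ × ⌊ suc n /2⌋ ≡ suc ⌊ n /2⌋
⌊1+n/2⌋-odd 1 _ = refl , refl
⌊1+n/2⌋-odd (suc (suc n)) odd = map₂ (cong suc) (⌊1+n/2⌋-odd n odd)

⌊m/2⌋<⌈n/2⌉ : ∀ {m n} → m < n → ⌊ m /2⌋ < ⌈ n /2⌉
⌊m/2⌋<⌈n/2⌉ m<n = ⌊n/2⌋-mono (s≤s m<n)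

odd⇒⌊m/2⌋<⌊n/2⌋ : ∀ {m n} → parity m ≡ 1ℙ → m < n → ⌊ m /2⌋ < ⌊ n /2⌋
odd⇒⌊m/2⌋<⌊n/2⌋ {m} odd m<n = subst (_≤ _) (proj₂ (⌊1+n/2⌋-odd m odd)) (⌊n/2⌋-mono m<n)

parity-view : ∀ n → parity n ≡ 0ℙ ⊎ parity n ≡ 1ℙ
parity-view n with parity n
... | 0ℙ = inj₁ refl
... | 1ℙ = inj₂ refl

-- Numbers are labels minus one.
cycleNumber : (p high low : ℕ) → ℕ → ℕ
cycleNumber p high low x with parity x
... | 0ℙ = low + ⌊ x /2⌋
... | 1ℙ = p ∸ suc (high + ⌊ x /2⌋)

cycleNumber-even : ∀ {p high low x} → parity x ≡ 0ℙ → cycleNumber p high low x ≡ low + ⌊ x /2⌋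
cycleNumber-even even rewrite even = refl

cycleNumber-odd : ∀ {p high low x} → parity x ≡ 1ℙ → cycleNumber p high low x ≡ p ∸ suc (high + ⌊ x /2⌋)
cycleNumber-odd odd rewrite odd = refl

module _ (p s : ℕ) where

  low+high≤ : ∀ {high low t₁ t₂} → t₁ ≤ suc t₂ → suc (high + t₂) ≤ p → low + (p + 2) ≤ high + s →
    suc (low + t₁) + suc (p ∸ suc (high + t₂)) ≤ s
  low+high≤ {high} {low} {t₁} {t₂} t₁≤1+t₂ high-fits gap = +-cancelʳ-≤ high _ s (begin
    suc (low + t₁) + suc D + high      ≤⟨ +-monoˡ-≤ high (+-monoˡ-≤ (suc D) (s≤s (+-monoʳ-≤ low t₁≤1+t₂))) ⟩
    suc (low + suc t₂) + suc D + high  ≡⟨ rearrange low t₂ D high ⟩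
    low + (D + suc (high + t₂) + 2)    ≡⟨ cong (λ n → low + (n + 2)) (m∸n+n≡m high-fits) ⟩
    low + (p + 2)                      ≤⟨ gap ⟩
    high + s                           ≡⟨ +-comm high s ⟩
    s + high                           ∎)
    where
    open ≤-Reasoning
    D = p ∸ suc (high + t₂)
    rearrange : ∀ low t D high → suc (low + suc t) + suc D + high ≡ low + (D + suc (high + t) + 2)
    rearrange = solve-∀

  low+low≤ : ∀ {low t} → 1 ≤ t → (low + suc t) + (low + suc t) ≤ suc s → suc (low + t) + suc (low + 0) ≤ s
  low+low≤ {low} {t} 1≤t wide = s≤s⁻¹ (begin
    suc X                         ≡⟨ +-comm 1 X ⟩
    X + 1                         ≤⟨ +-monoʳ-≤ X 1≤t ⟩
    X + t                         ≡⟨ rearrange low t ⟩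
    (low + suc t) + (low + suc t) ≤⟨ wide ⟩
    suc s                         ∎)
    where
    open ≤-Reasoning
    X = suc (low + t) + suc (low + 0)
    rearrange : ∀ low t → (suc (low + t) + suc (low + 0)) + t ≡ (low + suc t) + (low + suc t)
    rearrange = solve-∀

  module _ {c high low : ℕ} (3≤c : 3 ≤ c) (high-fits : high + ⌊ c /2⌋ ≤ p)
           (wide : (low + ⌈ c /2⌉) + (low + ⌈ c /2⌉) ≤ suc s) (gap : low + (p + 2) ≤ high + s) where

    private
      N = cycleNumber p high low

      edge : ∀ x y {m n} → N x ≡ m → N y ≡ n → suc m + suc n ≤ s → suc (N x) + suc (N y) ≤ s
      edge _ _ refl refl bound = bound

      even : ∀ {x} → parity x ≡ 0ℙ → N x ≡ low + ⌊ x /2⌋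
      even = cycleNumber-even {p} {high} {low}

      odd : ∀ {x} → parity x ≡ 1ℙ → N x ≡ p ∸ suc (high + ⌊ x /2⌋)
      odd = cycleNumber-odd {p} {high} {low}

      odd-fits : ∀ {y} → parity y ≡ 1ℙ → y < c → suc (high + ⌊ y /2⌋) ≤ p
      odd-fits odd y<c = ≤-trans (+-monoʳ-< high (odd⇒⌊m/2⌋<⌊n/2⌋ odd y<c)) high-fits

    cycleNumber-step : ∀ x → suc x < c → suc (N x) + suc (N (suc x)) ≤ s
    cycleNumber-step x x+1<c with parity-view x
    ... | inj₁ px = let (p[x+1] , ⌊x+1/2⌋) = ⌊1+n/2⌋-even x px in
      edge x (suc x) (even px) (trans (odd p[x+1]) (cong (λ t → p ∸ suc (high + t)) ⌊x+1/2⌋))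
        (low+high≤ (n≤1+n _) (subst (λ t → suc (high + t) ≤ p) ⌊x+1/2⌋ (odd-fits p[x+1] x+1<c)) gap)
    ... | inj₂ px = let (p[x+1] , ⌊x+1/2⌋) = ⌊1+n/2⌋-odd x px in
      subst (_≤ s) (+-comm (suc (N (suc x))) (suc (N x)))
        (edge (suc x) x (trans (even p[x+1]) (cong (low +_) ⌊x+1/2⌋)) (odd px)
          (low+high≤ ≤-refl (odd-fits px (<⇒≤ x+1<c)) gap))

    cycleNumber-wrap : ∀ x → suc x ≡ c → suc (N x) + suc (N 0) ≤ s
    cycleNumber-wrap x x+1≡c with parity-view x
    ... | inj₁ px = edge x 0 (even px) refl (low+low≤ 1≤⌊x/2⌋ wide′)
      where
      1≤⌊x/2⌋ : 1 ≤ ⌊ x /2⌋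
      1≤⌊x/2⌋ = ⌊n/2⌋-mono (s≤s⁻¹ (subst (3 ≤_) (sym x+1≡c) 3≤c))
      wide′ : (low + suc ⌊ x /2⌋) + (low + suc ⌊ x /2⌋) ≤ suc s
      wide′ = subst (λ n → (low + ⌈ n /2⌉) + (low + ⌈ n /2⌉) ≤ suc s) (sym x+1≡c) wide
    ... | inj₂ px = subst (_≤ s) (+-comm (suc (N 0)) (suc (N x))) (edge 0 x refl (odd px)
      (low+high≤ z≤n (odd-fits px (≤-reflexive x+1≡c)) gap))

    cycleNumber-edge : (a : Fin c) → suc (N (toℕ a)) + suc (N (toℕ (next a))) ≤ s
    cycleNumber-edge a with toℕ-next a
    ... | inj₁ (a+1<c , e) rewrite e = cycleNumber-step (toℕ a) a+1<c
    ... | inj₂ (a+1≡c , e) rewrite e = cycleNumber-wrap (toℕ a) a+1≡c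

sumBefore-⌊/2⌋-injective : ∀ g L {i j} {a : Fin (lookup L i)} {b : Fin (lookup L j)} →
  parity (toℕ a) ≡ parity (toℕ b) → ⌊ toℕ a /2⌋ < g (lookup L i) → ⌊ toℕ b /2⌋ < g (lookup L j) →
  sumBefore g L i + ⌊ toℕ a /2⌋ ≡ sumBefore g L j + ⌊ toℕ b /2⌋ → (i , a) ≡ (j , b)
sumBefore-⌊/2⌋-injective g L {i} {j} same-parity a< b< eq with sumBefore-injective g L i j a< b< eq
... | refl , same-half = cong (i ,_) (toℕ-injective (parity-⌊/2⌋-injective _ _ same-parity same-half))

number : (L : List ℕ) → Vertex L → ℕ
number L (i , a) = cycleNumber (order L) (sumBefore ⌊_/2⌋ L i) (sumBefore ⌈_/2⌉ L i) (toℕ a)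

module _ (L : List ℕ) where
  private
    p = order L
    E = evenPositions L
    O = oddPositions L

    E+O≡p : E + O ≡ p
    E+O≡p = sym (order≡evenPositions+oddPositions L)

    number-even : ∀ i (a : Fin (lookup L i)) → parity (toℕ a) ≡ 0ℙ →
      number L (i , a) ≡ sumBefore ⌈_/2⌉ L i + ⌊ toℕ a /2⌋
    number-even i a = cycleNumber-even {p} {sumBefore ⌊_/2⌋ L i} {sumBefore ⌈_/2⌉ L i}

    number-odd : ∀ i (a : Fin (lookup L i)) → parity (toℕ a) ≡ 1ℙ →
      number L (i , a) ≡ p ∸ suc (sumBefore ⌊_/2⌋ L i + ⌊ toℕ a /2⌋)
    number-odd i a = cycleNumber-odd {p} {sumBefore ⌊_/2⌋ L i} {sumBefore ⌈_/2⌉ L i}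

    low-< : ∀ i (a : Fin (lookup L i)) → sumBefore ⌈_/2⌉ L i + ⌊ toℕ a /2⌋ < E
    low-< i a = sumBefore-< ⌈_/2⌉ L i (⌊m/2⌋<⌈n/2⌉ (toℕ<n a))

    high-< : ∀ i (a : Fin (lookup L i)) → parity (toℕ a) ≡ 1ℙ → sumBefore ⌊_/2⌋ L i + ⌊ toℕ a /2⌋ < O
    high-< i a odd = sumBefore-< ⌊_/2⌋ L i (odd⇒⌊m/2⌋<⌊n/2⌋ odd (toℕ<n a))

    high-≤ : ∀ i (a : Fin (lookup L i)) → parity (toℕ a) ≡ 1ℙ → suc (sumBefore ⌊_/2⌋ L i + ⌊ toℕ a /2⌋) ≤ p
    high-≤ i a odd = ≤-trans (high-< i a odd) (subst (O ≤_) E+O≡p (m≤n+m O E))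

    E≤high : ∀ i (a : Fin (lookup L i)) → parity (toℕ a) ≡ 1ℙ → E ≤ p ∸ suc (sumBefore ⌊_/2⌋ L i + ⌊ toℕ a /2⌋)
    E≤high i a odd = subst (_≤ p ∸ suc (sumBefore ⌊_/2⌋ L i + ⌊ toℕ a /2⌋))
      (trans (cong (_∸ O) (sym E+O≡p)) (m+n∸n≡m E O)) (∸-monoʳ-≤ p (high-< i a odd))

  number-< : ∀ v → number L v < p
  number-< (i , a) with parity-view (toℕ a)
  ... | inj₁ even = subst (_< p) (sym (number-even i a even)) (<-≤-trans (low-< i a) (subst (E ≤_) E+O≡p (m≤m+n E O)))
  ... | inj₂ odd = subst (_< p) (sym (number-odd i a odd)) (∸-monoʳ-< z<s (high-≤ i a odd))

  number-injective : ∀ {v w} → number L v ≡ number L w → v ≡ w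
  number-injective {i , a} {j , b} eq with parity-view (toℕ a) | parity-view (toℕ b)
  ... | inj₁ pa | inj₁ pb = sumBefore-⌊/2⌋-injective ⌈_/2⌉ L (trans pa (sym pb))
    (⌊m/2⌋<⌈n/2⌉ (toℕ<n a)) (⌊m/2⌋<⌈n/2⌉ (toℕ<n b))
    (trans (sym (number-even i a pa)) (trans eq (number-even j b pb)))
  ... | inj₂ pa | inj₂ pb = sumBefore-⌊/2⌋-injective ⌊_/2⌋ L (trans pa (sym pb))
    (odd⇒⌊m/2⌋<⌊n/2⌋ pa (toℕ<n a)) (odd⇒⌊m/2⌋<⌊n/2⌋ pb (toℕ<n b))
    (suc-injective (∸-cancelˡ-≡ (high-≤ i a pa) (high-≤ j b pb)
      (trans (sym (number-odd i a pa)) (trans eq (number-odd j b pb)))))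
  ... | inj₁ pa | inj₂ pb = contradiction (trans (sym (number-even i a pa)) (trans eq (number-odd j b pb)))
    (<⇒≢ (<-≤-trans (low-< i a) (E≤high j b pb)))
  ... | inj₂ pa | inj₁ pb = contradiction (trans (sym (number-even j b pb)) (trans (sym eq) (number-odd i a pa)))
    (<⇒≢ (<-≤-trans (low-< j b) (E≤high i a pa)))

numbering : ∀ L → Numbering L
numbering L = injective⇒numbering L (λ v → fromℕ< (number-< L v))
  (λ eq → number-injective L (trans (sym (toℕ-fromℕ< _)) (trans (cong toℕ eq) (toℕ-fromℕ< _))))

-- sumBefore ⌈_/2⌉ L i ∸ sumBefore ⌊_/2⌋ L i is the number of odd cycles before cycle i, and
-- the edges of cycle i get label sums up to p + 2 plus that number.
Fits : (p s : ℕ) → List ℕ → Set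
Fits p s L = ∀ i → sumBefore ⌈_/2⌉ L i + (p + 2) ≤ sumBefore ⌊_/2⌋ L i + s

strF-numbering-≤ : ∀ L s → (∀ i → 3 ≤ lookup L i) → evenPositions L + evenPositions L ≤ suc s →
  Fits (order L) s L → strF L (numbering L) ≤ s
strF-numbering-≤ L s long wide fits = strF≤ L (numbering L) λ i a →
  subst₂ (λ m n → suc m + suc n ≤ s) (sym (toℕ-fromℕ< _)) (sym (toℕ-fromℕ< _))
    (cycleNumber-edge (order L) s (long i) (high-fits i) (wide-at i) (fits i) a)
  where
  high-fits : ∀ i → sumBefore ⌊_/2⌋ L i + ⌊ lookup L i /2⌋ ≤ order L
  high-fits i = ≤-trans (sumBefore+≤sum ⌊_/2⌋ L i)
    (subst (oddPositions L ≤_) (sym (order≡evenPositions+oddPositions L)) (m≤n+m _ _))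
  wide-at : ∀ i → (sumBefore ⌈_/2⌉ L i + ⌈ lookup L i /2⌉) + (sumBefore ⌈_/2⌉ L i + ⌈ lookup L i /2⌉) ≤ suc s
  wide-at i = ≤-trans (+-mono-≤ (sumBefore+≤sum ⌈_/2⌉ L i) (sumBefore+≤sum ⌈_/2⌉ L i)) wide

Fits-∷ : ∀ {p s s′ c L} → p + 2 ≤ s → ⌈ c /2⌉ + s′ ≤ ⌊ c /2⌋ + s → Fits p s′ L → Fits p s (c ∷ L)
Fits-∷ p+2≤s _ _ Fin.zero = +-monoʳ-≤ 0 p+2≤s
Fits-∷ {p} {s} {s′} {c} {L} _ slack fits (Fin.suc i) = begin
  (⌈ c /2⌉ + sumBefore ⌈_/2⌉ L i) + (p + 2) ≡⟨ +-assoc ⌈ c /2⌉ _ _ ⟩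
  ⌈ c /2⌉ + (sumBefore ⌈_/2⌉ L i + (p + 2)) ≤⟨ +-monoʳ-≤ ⌈ c /2⌉ (fits i) ⟩
  ⌈ c /2⌉ + (sumBefore ⌊_/2⌋ L i + s′)      ≡⟨ x∙yz≈y∙xz ⌈ c /2⌉ _ s′ ⟩
  sumBefore ⌊_/2⌋ L i + (⌈ c /2⌉ + s′)      ≤⟨ +-monoʳ-≤ (sumBefore ⌊_/2⌋ L i) slack ⟩
  sumBefore ⌊_/2⌋ L i + (⌊ c /2⌋ + s)       ≡⟨ xy∙z≈y∙xz ⌊ c /2⌋ _ s ⟨
  (⌊ c /2⌋ + sumBefore ⌊_/2⌋ L i) + s       ∎
  where open ≤-Reasoning

2*m≡m+m : ∀ m → 2 * m ≡ m + m
2*m≡m+m m = cong (m +_) (+-identityʳ m)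

⌊2*m/2⌋≡m : ∀ m → ⌊ 2 * m /2⌋ ≡ m
⌊2*m/2⌋≡m m = trans (cong ⌊_/2⌋ (2*m≡m+m m)) (sym (n≡⌊n+n/2⌋ m))

⌈2*m/2⌉≡m : ∀ m → ⌈ 2 * m /2⌉ ≡ m
⌈2*m/2⌉≡m m = trans (cong ⌈_/2⌉ (2*m≡m+m m)) (sym (n≡⌈n+n/2⌉ m))

2*n+1≡1+n+n : ∀ n → 2 * n + 1 ≡ suc (n + n)
2*n+1≡1+n+n n = trans (+-comm (2 * n) 1) (cong suc (2*m≡m+m n))

⌊2*n+1/2⌋≡n : ∀ n → ⌊ 2 * n + 1 /2⌋ ≡ n
⌊2*n+1/2⌋≡n n = trans (cong ⌊_/2⌋ (2*n+1≡1+n+n n)) (sym (n≡⌈n+n/2⌉ n))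

⌈2*n+1/2⌉≡1+n : ∀ n → ⌈ 2 * n + 1 /2⌉ ≡ suc n
⌈2*n+1/2⌉≡1+n n = trans (cong ⌈_/2⌉ (2*n+1≡1+n+n n)) (cong suc (sym (n≡⌊n+n/2⌋ n)))

⌈2*m/2⌉≡⌊2*m/2⌋ : ∀ m → ⌈ 2 * m /2⌉ ≡ ⌊ 2 * m /2⌋
⌈2*m/2⌉≡⌊2*m/2⌋ m = trans (⌈2*m/2⌉≡m m) (sym (⌊2*m/2⌋≡m m))

evenPositions-cycleList : ∀ ms ns →
  evenPositions (cycleList ms ns) ≡ oddPositions (cycleList ms ns) + length ns
evenPositions-cycleList [] [] = refl
evenPositions-cycleList [] (n ∷ ns) = begin
  ⌈ 2 * n + 1 /2⌉ + E             ≡⟨ cong₂ _+_ (⌈2*n+1/2⌉≡1+n n) (evenPositions-cycleList [] ns) ⟩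
  suc n + (O + length ns)         ≡⟨ rearrange n O (length ns) ⟩
  n + O + suc (length ns)         ≡⟨ cong (λ x → x + O + suc (length ns)) (⌊2*n+1/2⌋≡n n) ⟨
  ⌊ 2 * n + 1 /2⌋ + O + suc (length ns) ∎
  where
  open ≡-Reasoning
  E = evenPositions (cycleList [] ns)
  O = oddPositions (cycleList [] ns)
  rearrange : ∀ n O k → suc n + (O + k) ≡ n + O + suc k
  rearrange = solve-∀
evenPositions-cycleList (m ∷ ms) ns = begin
  ⌈ 2 * m /2⌉ + E               ≡⟨ cong₂ _+_ (⌈2*m/2⌉≡⌊2*m/2⌋ m) (evenPositions-cycleList ms ns) ⟩
  ⌊ 2 * m /2⌋ + (O + length ns) ≡⟨ +-assoc ⌊ 2 * m /2⌋ O (length ns) ⟨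
  ⌊ 2 * m /2⌋ + O + length ns   ∎
  where
  open ≡-Reasoning
  E = evenPositions (cycleList ms ns)
  O = oddPositions (cycleList ms ns)

1+2*evenPositions-cycleList : ∀ ms ns →
  suc (evenPositions (cycleList ms ns) + evenPositions (cycleList ms ns)) ≡ order (cycleList ms ns) + 1 + length ns
1+2*evenPositions-cycleList ms ns = begin
  suc (E + E)            ≡⟨ cong (λ n → suc (E + n)) (evenPositions-cycleList ms ns) ⟩
  suc (E + (O + k))      ≡⟨ cong suc (+-assoc E O k) ⟨
  suc (E + O + k)        ≡⟨ cong (λ n → suc (n + k)) (order≡evenPositions+oddPositions L) ⟨
  suc (order L + k)      ≡⟨ cong (_+ k) (+-comm 1 (order L)) ⟩
  order L + 1 + k        ∎
  where
  open ≡-Reasoning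
  L = cycleList ms ns
  E = evenPositions L
  O = oddPositions L
  k = length ns

fits-odd-cycles : ∀ p ns s → p + 1 + length ns ≤ s → Fits p s (cycleList [] ns)
fits-odd-cycles p [] s _ ()
fits-odd-cycles p (n ∷ ns) zero bound = contradiction (n≤0⇒n≡0 bound) (m+1+n≢0 (p + 1))
fits-odd-cycles p (n ∷ ns) (suc s) bound =
  Fits-∷ p+2≤1+s (≤-reflexive slack)
    (fits-odd-cycles p ns s (s≤s⁻¹ (subst (_≤ suc s) (+-suc (p + 1) (length ns)) bound)))
  where
  slack : ⌈ 2 * n + 1 /2⌉ + s ≡ ⌊ 2 * n + 1 /2⌋ + suc s
  slack = begin
    ⌈ 2 * n + 1 /2⌉ + s     ≡⟨ cong (_+ s) (⌈2*n+1/2⌉≡1+n n) ⟩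
    suc n + s               ≡⟨ +-suc n s ⟨
    n + suc s               ≡⟨ cong (_+ suc s) (⌊2*n+1/2⌋≡n n) ⟨
    ⌊ 2 * n + 1 /2⌋ + suc s ∎
    where open ≡-Reasoning
  p+2≤1+s : p + 2 ≤ suc s
  p+2≤1+s = ≤-trans (≤-reflexive (sym (+-assoc p 1 1))) (≤-trans (+-monoʳ-≤ (p + 1) (s≤s z≤n)) bound)

fits-cycleList : ∀ p s ms ns → p + 2 ≤ s → p + 1 + length ns ≤ s → Fits p s (cycleList ms ns)
fits-cycleList p s [] ns _ odd-bound = fits-odd-cycles p ns s odd-bound
fits-cycleList p s (m ∷ ms) ns even-bound odd-bound =
  Fits-∷ even-bound (≤-reflexive (cong (_+ s) (⌈2*m/2⌉≡⌊2*m/2⌋ m)))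
    (fits-cycleList p s ms ns even-bound odd-bound)

cycleList-long : ∀ {ms ns} → All (λ m → 2 ≤ m) ms → All (λ n → 1 ≤ n) ns →
  ∀ i → 3 ≤ lookup (cycleList ms ns) i
cycleList-long 2≤ms 1≤ns i =
  All.lookup {P = 3 ≤_} (++⁺ (map⁺ (All.map even-long 2≤ms)) (map⁺ (All.map odd-long 1≤ns))) (∈-lookup i)
  where
  even-long : ∀ {m} → 2 ≤ m → 3 ≤ 2 * m
  even-long 2≤m = ≤-trans (n≤1+n 3) (*-monoʳ-≤ 2 2≤m)
  odd-long : ∀ {n} → 1 ≤ n → 3 ≤ 2 * n + 1
  odd-long 1≤n = +-monoˡ-≤ 1 (*-monoʳ-≤ 2 1≤n)

1≤order : ∀ L → (∀ i → 1 ≤ lookup L i) → 1 ≤ length L → 1 ≤ order L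
1≤order (c ∷ L) positive _ = ≤-trans (positive Fin.zero) (m≤m+n c (order L))

length-cycleList : ∀ ms ns → length (cycleList ms ns) ≡ length ms + length ns
length-cycleList ms ns = trans (length-++ (map _ ms)) (cong₂ _+_ (length-map _ ms) (length-map _ ns))

mainTheorem5 : (ms ns : List ℕ) → All (λ m → 2 ≤ m) ms → All (λ n → 1 ≤ n) ns →
    1 ≤ length ms + length ns →
    IsStrength (cycleList ms ns)
      ((order (cycleList ms ns) + 2) ⊔ (order (cycleList ms ns) + 1 + length ns))
mainTheorem5 ms ns 2≤ms 1≤ns nonempty = (numbering L , ≤-antisym upper (lower (numbering L))) , lower
  where
  L = cycleList ms ns
  p = order L
  k = length ns
  long : ∀ i → 3 ≤ lookup L i
  long = cycleList-long 2≤ms 1≤ns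
  2E+1≡p+1+k : suc (evenPositions L + evenPositions L) ≡ p + 1 + k
  2E+1≡p+1+k = 1+2*evenPositions-cycleList ms ns
  upper : strF L (numbering L) ≤ (p + 2) ⊔ (p + 1 + k)
  upper = strF-numbering-≤ L _ long
    (≤-trans (n≤1+n _) (≤-trans (≤-reflexive 2E+1≡p+1+k) (≤-trans (m≤n⊔m _ _) (n≤1+n _))))
    (fits-cycleList p _ ms ns (m≤m⊔n _ _) (m≤n⊔m _ _))
  lower : ∀ f → (p + 2) ⊔ (p + 1 + k) ≤ strF L f
  lower f = ⊔-lub p+2≤s (subst (_≤ strF L f) 2E+1≡p+1+k
    (2*evenPositions<strF L f (λ i → ≤-trans (n≤1+n 2) (long i)) (≤-trans (s≤s z≤n) (≤-trans (m≤n+m 2 p) p+2≤s))))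
    where
    p+2≤s : p + 2 ≤ strF L f
    p+2≤s = order+2≤strF L f long
      (1≤order L (λ i → ≤-trans (s≤s z≤n) (long i)) (subst (1 ≤_) (sym (length-cycleList ms ns)) nonempty))
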